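{- Let $m_1,m_2$ be positive integers and let $C=\{(x_1,y_1),\dots,(x_k,y_k)\}$ ($k\ge 0$) be a strict chain in $[m_1]\times[m_2]$ with $x_1<\dots<x_k$. Then $C$ is a maximal strict chain if and only if its associated $(h,v,d)$-word contains no occurrence of the two consecutive letters $vh$.
   Context: $[m]=\{1,\dots,m\}$. A strict chain in $[m_1]\times[m_2]$ is a subset any two distinct elements $(a,b),(c,d)$ of which satisfy either $a>c$ and $b>d$, or $a<c$ and $b<d$ (so for $x_1<\dots<x_k$ one also has $y_1<\dots<y_k$); it is maximal if not properly contained in another strict chain. The associated $(h,v,d)$-word describes the grid line going from the NW corner to the SE corner of the $m_1\times m_2$ grid (rows $1..m_1$ top to bottom, columns $1..m_2$ left to right) bounding the region of cells $(x',y')$ with $x'\ge x_i$, $y'\le y_i$ for some $i$, where $v$ is a downward unit move, $h$ a rightward unit move and $d$ a diagonal move through a cell of $C$. Explicitly, with $x_0=y_0=0$, the word is $v^{x_1-x_0-1}h^{y_1-y_0-1}\,d\,v^{x_2-x_1-1}h^{y_2-y_1-1}\,d\cdots d\,v^{x_k-x_{k-1}-1}h^{y_k-y_{k-1}-1}\,d\,v^{m_1-x_k}h^{m_2-y_k}$ (for $k=0$ it is $v^{m_1}h^{m_2}$), where $a^n$ denotes $n$ repetitions of the letter $a$. -}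

module Defs where

open import Data.Nat using (ℕ; _<_; _≤_; _∸_)
open import Data.Product using (_×_; _,_; proj₁; proj₂; ∃-syntax)
open import Data.Sum using (_⊎_)
open import Data.List using (List; []; _∷_; _++_; replicate)
open import Data.List.Relation.Unary.All using (All)
open import Data.List.Relation.Unary.Linked using (Linked)
open import Data.List.Membership.Propositional using (_∈_)
open import Relation.Binary.PropositionalEquality using (_≡_)
open import Relation.Nullary using (¬_)

Point : Set
Point = ℕ × ℕ

InGrid : ℕ → ℕ → Point → Set
InGrid m₁ m₂ (x , y) = (1 ≤ x × x ≤ m₁) × (1 ≤ y × y ≤ m₂)

_≺_ : Point → Point → Set
(a , b) ≺ (c , d) = a < c × b < d

-- a finite subset of the grid, given by a list of its elements
GridSubset : ℕ → ℕ → List Point → Set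
GridSubset m₁ m₂ S = All (InGrid m₁ m₂) S

StrictChain : List Point → Set
StrictChain S = ∀ {p q} → p ∈ S → q ∈ S → ¬ (p ≡ q) → (p ≺ q ⊎ q ≺ p)

MaximalStrictChain : ℕ → ℕ → List Point → Set
MaximalStrictChain m₁ m₂ S =
  GridSubset m₁ m₂ S × StrictChain S ×
  (∀ (D : List Point) → GridSubset m₁ m₂ D → StrictChain D →
     (∀ {p} → p ∈ S → p ∈ D) → ∀ {q} → q ∈ D → q ∈ S)

XIncreasing : List Point → Set
XIncreasing S = Linked (λ p q → proj₁ p < proj₁ q) S

data Letter : Set where
  h v d : Letter

-- word of the remaining chain, starting from previous point (x₀ , y₀)
wordFrom : ℕ → ℕ → ℕ → ℕ → List Point → List Letter
wordFrom m₁ m₂ x₀ y₀ [] = replicate (m₁ ∸ x₀) v ++ replicate (m₂ ∸ y₀) h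
wordFrom m₁ m₂ x₀ y₀ ((x , y) ∷ S) =
  replicate (x ∸ x₀ ∸ 1) v ++ (replicate (y ∸ y₀ ∸ 1) h ++ (d ∷ wordFrom m₁ m₂ x y S))

hvdWord : ℕ → ℕ → List Point → List Letter
hvdWord m₁ m₂ S = wordFrom m₁ m₂ 0 0 S

ContainsVH : List Letter → Set
ContainsVH w = ∃[ u ] ∃[ t ] (w ≡ u ++ (v ∷ h ∷ t))

-- A point q can be added to the chain C exactly when it lies in the grid strictly
-- between two consecutive corners of the staircase (x₀,y₀) = (0,0), (x₁,y₁), …, (x_k,y_k),
-- (m₁+1, m₂+1). Since the chain is strictly increasing, such a q exists between (x₀,y₀)
-- and (x,y) iff x₀ + 1 < x and y₀ + 1 < y, i.e. iff the block v^(x-x₀-1) h^(y-y₀-1) of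
-- the word has both letters; and a vh can only occur inside such a block, because the
-- blocks are separated by d's.
module Submission where

open import Defs
open import Data.Nat using (ℕ; zero; suc; _<_; _∸_; z≤n; s≤s; z<s)
open import Data.Nat.Properties
  using (_≟_; n<1+n; <-trans; <-irrefl; ≤-trans; <⇒≤; m<n⇒0<n∸m; m∸n≢0⇒n<m; ∸-+-assoc; +-comm)
open import Data.Product using (_×_; _,_; proj₁; ∃-syntax; ∃)
open import Data.Product.Properties using (≡-dec)
open import Data.Sum using (_⊎_; inj₁; inj₂; swap)
import Data.Sum as Sum
open import Data.List using (List; []; _∷_; _++_; replicate)
open import Data.List.Properties using (++-assoc; ++-identityʳ; ∷-injectiveʳ)
open import Data.List.Relation.Unary.All as All using (All; []; _∷_)
open import Data.List.Relation.Unary.Any using (here; there)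
open import Data.List.Relation.Unary.AllPairs using (AllPairs; []; _∷_)
open import Data.List.Relation.Unary.Linked using (Linked; []; [-]; _∷_)
open import Data.List.Relation.Unary.Linked.Properties using (Linked⇒AllPairs)
open import Data.List.Membership.Propositional using (_∈_)
open import Data.List.Membership.DecPropositional (≡-dec _≟_ _≟_) using (_∈?_)
open import Data.Empty using (⊥-elim)
open import Function.Base using (_∘_)
open import Function.Bundles using (_⇔_; mk⇔; Equivalence)
open import Relation.Binary.PropositionalEquality using (_≡_; refl; sym; trans; cong; subst)
open import Relation.Nullary using (¬_; yes; no; contraposition)

0<m∸n⇒n<m : ∀ {m n} → 0 < m ∸ n → n < m
0<m∸n⇒n<m 0<m∸n = m∸n≢0⇒n<m (λ m∸n≡0 → <-irrefl (sym m∸n≡0) 0<m∸n)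

m∸n∸1≡m∸[1+n] : ∀ m n → m ∸ n ∸ 1 ≡ m ∸ suc n
m∸n∸1≡m∸[1+n] m n = trans (∸-+-assoc m n 1) (cong (m ∸_) (+-comm n 1))

1+n<m⇒0<m∸n∸1 : ∀ {m n} → suc n < m → 0 < m ∸ n ∸ 1
1+n<m⇒0<m∸n∸1 {m} {n} lt = subst (0 <_) (sym (m∸n∸1≡m∸[1+n] m n)) (m<n⇒0<n∸m lt)

0<m∸n∸1⇒1+n<m : ∀ {m n} → 0 < m ∸ n ∸ 1 → suc n < m
0<m∸n∸1⇒1+n<m {m} {n} pos = 0<m∸n⇒n<m (subst (0 <_) (m∸n∸1≡m∸[1+n] m n) pos)

StartsWithH : List Letter → Set
StartsWithH w = ∃[ t ] (w ≡ h ∷ t)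

ContainsVH-++⁺ : ∀ u {w} → ContainsVH w → ContainsVH (u ++ w)
ContainsVH-++⁺ u (u′ , t , refl) = u ++ u′ , t , sym (++-assoc u u′ (v ∷ h ∷ t))

ContainsVH-∷⁻ : ∀ {c w} → ContainsVH (c ∷ w) → (c ≡ v × StartsWithH w) ⊎ ContainsVH w
ContainsVH-∷⁻ ([]    , t , refl) = inj₁ (refl , t , refl)
ContainsVH-∷⁻ (_ ∷ u , t , eq)   = inj₂ (u , t , ∷-injectiveʳ eq)

¬ContainsVH[] : ¬ ContainsVH []
¬ContainsVH[] ([]    , _ , ())
¬ContainsVH[] (_ ∷ _ , _ , ())

ContainsVH-d∷⁻ : ∀ {w} → ContainsVH (d ∷ w) → ContainsVH w
ContainsVH-d∷⁻ vh with ContainsVH-∷⁻ vh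
... | inj₁ (() , _)
... | inj₂ vh′ = vh′

ContainsVH-replicate-h⁻ : ∀ b {w} → ContainsVH (replicate b h ++ w) → ContainsVH w
ContainsVH-replicate-h⁻ zero    vh = vh
ContainsVH-replicate-h⁻ (suc b) vh with ContainsVH-∷⁻ vh
... | inj₁ (() , _)
... | inj₂ vh′ = ContainsVH-replicate-h⁻ b vh′

ContainsVH-block⁺ : ∀ a b w → 0 < a → 0 < b → ContainsVH (replicate a v ++ (replicate b h ++ w))
ContainsVH-block⁺ (suc zero)    (suc b) w _ _ = [] , replicate b h ++ w , refl
ContainsVH-block⁺ (suc (suc a)) b       w _ 0<b =
  ContainsVH-++⁺ (v ∷ []) (ContainsVH-block⁺ (suc a) b w z<s 0<b)

StartsWithH-block⁻ : ∀ a b {w} → ¬ StartsWithH w →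
  StartsWithH (replicate a v ++ (replicate b h ++ w)) → 0 < b
StartsWithH-block⁻ (suc a) b     ¬hw (_ , ())
StartsWithH-block⁻ zero    (suc b) ¬hw _ = z<s
StartsWithH-block⁻ zero    zero    ¬hw hw = ⊥-elim (¬hw hw)

ContainsVH-block⁻ : ∀ a b {w} → ¬ StartsWithH w →
  ContainsVH (replicate a v ++ (replicate b h ++ w)) → (0 < a × 0 < b) ⊎ ContainsVH w
ContainsVH-block⁻ zero    b ¬hw vh = inj₂ (ContainsVH-replicate-h⁻ b vh)
ContainsVH-block⁻ (suc a) b ¬hw vh with ContainsVH-∷⁻ vh
... | inj₁ (_ , hw) = inj₁ (z<s , StartsWithH-block⁻ a b ¬hw hw)
... | inj₂ vh′      = Sum.map₁ (λ (_ , 0<b) → z<s , 0<b) (ContainsVH-block⁻ a b ¬hw vh′)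

≺-trans : ∀ {p q r} → p ≺ q → q ≺ r → p ≺ r
≺-trans (x<x′ , y<y′) (x′<x″ , y′<y″) = <-trans x<x′ x′<x″ , <-trans y<y′ y′<y″

≺-irrefl : ∀ {p} → ¬ (p ≺ p)
≺-irrefl (x<x , _) = <-irrefl refl x<x

Comparable : Point → Point → Set
Comparable p q = p ≺ q ⊎ q ≺ p

Comparable-irrefl : ∀ {p} → ¬ Comparable p p
Comparable-irrefl (inj₁ p≺p) = ≺-irrefl p≺p
Comparable-irrefl (inj₂ p≺p) = ≺-irrefl p≺p

InGrid⇒0≺ : ∀ {m₁ m₂ p} → InGrid m₁ m₂ p → (0 , 0) ≺ p
InGrid⇒0≺ ((1≤x , _) , (1≤y , _)) = 1≤x , 1≤y

StrictChain-∷ : ∀ {q C} → All (Comparable q) C → StrictChain C → StrictChain (q ∷ C)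
StrictChain-∷ cmp chain (here refl) (here refl) q≢q = ⊥-elim (q≢q refl)
StrictChain-∷ cmp chain (here refl) (there p∈C) _   = All.lookup cmp p∈C
StrictChain-∷ cmp chain (there p∈C) (here refl) _   = swap (All.lookup cmp p∈C)
StrictChain-∷ cmp chain (there p∈C) (there q∈C) p≢q = chain p∈C q∈C p≢q

StrictChain∧XIncreasing⇒Linked : ∀ C → StrictChain C → XIncreasing C → Linked _≺_ C
StrictChain∧XIncreasing⇒Linked []          _     _ = []
StrictChain∧XIncreasing⇒Linked (_ ∷ [])    _     _ = [-]
StrictChain∧XIncreasing⇒Linked (p ∷ q ∷ C) chain (x<x′ ∷ incr)
  with chain (here refl) (there (here refl)) (λ p≡q → <-irrefl (cong proj₁ p≡q) x<x′)
... | inj₁ p≺q = p≺q ∷ StrictChain∧XIncreasing⇒Linked (q ∷ C) (λ i j → chain (there i) (there j)) incr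
... | inj₂ (x′<x , _) = ⊥-elim (<-irrefl refl (<-trans x<x′ x′<x))

module _ (m₁ m₂ : ℕ) where

  -- then q ∉ C, and q ∷ C is a strict chain in the grid properly containing C
  Extends : List Point → Point → Set
  Extends C q = InGrid m₁ m₂ q × All (Comparable q) C

  maximal⇒¬extendable : ∀ {C} → MaximalStrictChain m₁ m₂ C → ¬ ∃ (Extends C)
  maximal⇒¬extendable {C} (grid , chain , maximal) (q , q∈grid , cmp) =
    Comparable-irrefl (All.lookup cmp q∈C)
    where
    q∈C : q ∈ C
    q∈C = maximal (q ∷ C) (q∈grid ∷ grid) (StrictChain-∷ cmp chain) there (here refl)

  ¬extendable⇒maximal : ∀ {C} → GridSubset m₁ m₂ C → StrictChain C → ¬ ∃ (Extends C) →
    MaximalStrictChain m₁ m₂ C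
  ¬extendable⇒maximal {C} grid chain ¬ext = grid , chain , maximal
    where
    maximal : ∀ D → GridSubset m₁ m₂ D → StrictChain D →
      (∀ {p} → p ∈ C → p ∈ D) → ∀ {q} → q ∈ D → q ∈ C
    maximal D gridD chainD C⊆D {q} q∈D with q ∈? C
    ... | yes q∈C = q∈C
    ... | no  q∉C = ⊥-elim (¬ext (q , All.lookup gridD q∈D , All.tabulate comparable))
      where
      comparable : ∀ {p} → p ∈ C → Comparable q p
      comparable p∈C = swap (chainD (C⊆D p∈C) q∈D (λ p≡q → q∉C (subst (_∈ C) p≡q p∈C)))

  wordFrom[]≡block : ∀ x₀ y₀ →
    wordFrom m₁ m₂ x₀ y₀ [] ≡ replicate (m₁ ∸ x₀) v ++ (replicate (m₂ ∸ y₀) h ++ [])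
  wordFrom[]≡block x₀ y₀ = cong (replicate (m₁ ∸ x₀) v ++_) (sym (++-identityʳ (replicate (m₂ ∸ y₀) h)))

  ContainsVH-wordFrom⇒extendable : ∀ x₀ y₀ C → AllPairs _≺_ ((x₀ , y₀) ∷ C) → GridSubset m₁ m₂ C →
    ContainsVH (wordFrom m₁ m₂ x₀ y₀ C) → ∃[ q ] ((x₀ , y₀) ≺ q × Extends C q)
  ContainsVH-wordFrom⇒extendable x₀ y₀ [] _ _ vh
    with ContainsVH-block⁻ (m₁ ∸ x₀) (m₂ ∸ y₀) (λ ()) (subst ContainsVH (wordFrom[]≡block x₀ y₀) vh)
  ... | inj₂ vh′ = ⊥-elim (¬ContainsVH[] vh′)
  ... | inj₁ (0<m₁∸x₀ , 0<m₂∸y₀) =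
    (suc x₀ , suc y₀) , (n<1+n x₀ , n<1+n y₀) ,
    ((s≤s z≤n , 0<m∸n⇒n<m 0<m₁∸x₀) , (s≤s z≤n , 0<m∸n⇒n<m 0<m₂∸y₀)) , []
  ContainsVH-wordFrom⇒extendable x₀ y₀ ((x , y) ∷ C)
    ((x₀y₀≺xy ∷ _) ∷ xy≺C ∷ pairs) (((_ , x≤m₁) , (_ , y≤m₂)) ∷ grid) vh
    with ContainsVH-block⁻ (x ∸ x₀ ∸ 1) (y ∸ y₀ ∸ 1) (λ ()) vh
  ... | inj₁ (gapˣ , gapʸ) =
    (suc x₀ , suc y₀) , (n<1+n x₀ , n<1+n y₀) ,
    ((s≤s z≤n , ≤-trans (<⇒≤ 1+x₀<x) x≤m₁) , (s≤s z≤n , ≤-trans (<⇒≤ 1+y₀<y) y≤m₂)) ,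
    inj₁ q≺xy ∷ All.map (inj₁ ∘ ≺-trans q≺xy) xy≺C
    where
    1+x₀<x : suc x₀ < x
    1+x₀<x = 0<m∸n∸1⇒1+n<m gapˣ

    1+y₀<y : suc y₀ < y
    1+y₀<y = 0<m∸n∸1⇒1+n<m gapʸ

    q≺xy : (suc x₀ , suc y₀) ≺ (x , y)
    q≺xy = 1+x₀<x , 1+y₀<y
  ... | inj₂ vh′ with ContainsVH-wordFrom⇒extendable x y C (xy≺C ∷ pairs) grid (ContainsVH-d∷⁻ vh′)
  ...   | q , xy≺q , q∈grid , cmp = q , ≺-trans x₀y₀≺xy xy≺q , q∈grid , inj₂ xy≺q ∷ cmp

  extendable⇒ContainsVH-wordFrom : ∀ x₀ y₀ C {q} → (x₀ , y₀) ≺ q → Extends C q →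
    ContainsVH (wordFrom m₁ m₂ x₀ y₀ C)
  extendable⇒ContainsVH-wordFrom x₀ y₀ [] (x₀<a , y₀<b) (((_ , a≤m₁) , (_ , b≤m₂)) , _) =
    subst ContainsVH (sym (wordFrom[]≡block x₀ y₀))
      (ContainsVH-block⁺ (m₁ ∸ x₀) (m₂ ∸ y₀) []
        (m<n⇒0<n∸m (≤-trans x₀<a a≤m₁)) (m<n⇒0<n∸m (≤-trans y₀<b b≤m₂)))
  extendable⇒ContainsVH-wordFrom x₀ y₀ ((x , y) ∷ C) (x₀<a , y₀<b) (_ , inj₁ (a<x , b<y) ∷ _) =
    ContainsVH-block⁺ (x ∸ x₀ ∸ 1) (y ∸ y₀ ∸ 1) _
      (1+n<m⇒0<m∸n∸1 (≤-trans (s≤s x₀<a) a<x)) (1+n<m⇒0<m∸n∸1 (≤-trans (s≤s y₀<b) b<y))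
  extendable⇒ContainsVH-wordFrom x₀ y₀ ((x , y) ∷ C) _ (q∈grid , inj₂ xy≺q ∷ cmp) =
    ContainsVH-++⁺ (replicate (x ∸ x₀ ∸ 1) v) (ContainsVH-++⁺ (replicate (y ∸ y₀ ∸ 1) h)
      (ContainsVH-++⁺ (d ∷ []) (extendable⇒ContainsVH-wordFrom x y C xy≺q (q∈grid , cmp))))

  ContainsVH-hvdWord⇔extendable : ∀ {C} → GridSubset m₁ m₂ C → Linked _≺_ C →
    ContainsVH (hvdWord m₁ m₂ C) ⇔ ∃ (Extends C)
  ContainsVH-hvdWord⇔extendable {C} grid linked = mk⇔ vh⇒ext ext⇒vh
    where
    pairs : AllPairs _≺_ ((0 , 0) ∷ C)
    pairs = All.map InGrid⇒0≺ grid ∷ Linked⇒AllPairs ≺-trans linked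

    vh⇒ext : ContainsVH (hvdWord m₁ m₂ C) → ∃ (Extends C)
    vh⇒ext vh with ContainsVH-wordFrom⇒extendable 0 0 C pairs grid vh
    ... | q , _ , ext = q , ext

    ext⇒vh : ∃ (Extends C) → ContainsVH (hvdWord m₁ m₂ C)
    ext⇒vh (q , ext) = extendable⇒ContainsVH-wordFrom 0 0 C (InGrid⇒0≺ (proj₁ ext)) ext

proposition8 : (m₁ m₂ : ℕ) → 0 < m₁ → 0 < m₂ → (C : List Point) →
    GridSubset m₁ m₂ C → StrictChain C → XIncreasing C →
    (MaximalStrictChain m₁ m₂ C ⇔ (¬ ContainsVH (hvdWord m₁ m₂ C)))
proposition8 m₁ m₂ _ _ C grid chain incr = mk⇔
  (λ maximal → contraposition (Equivalence.to vh⇔ext) (maximal⇒¬extendable m₁ m₂ maximal))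
  (λ ¬vh → ¬extendable⇒maximal m₁ m₂ grid chain (contraposition (Equivalence.from vh⇔ext) ¬vh))
  where
  vh⇔ext : ContainsVH (hvdWord m₁ m₂ C) ⇔ ∃ (Extends m₁ m₂ C)
  vh⇔ext = ContainsVH-hvdWord⇔extendable m₁ m₂ grid (StrictChain∧XIncreasing⇒Linked C chain incr)
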